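{- Let $D$ be a single source DAG with $n$ nodes. Then the burning number of $D$ is at most $\left\lceil \sqrt{2n+\frac{1}{4}}-\frac{1}{2}\right\rceil$.
   Context: A single source DAG is a finite directed acyclic graph with exactly one node of in-degree $0$. Burning process on a digraph $D$: a sequence $(x_1,\ldots,x_b)$ of nodes is a burning sequence for $D$ if after $b$ steps of the following process every node of $D$ is burned. In the $i$-th step, first all out-neighbours of all currently burned nodes become burned, and then the node $x_i$ is burned (so after step 1 only $x_1$ is burned). The burning number of $D$ is the length of a shortest burning sequence for $D$. -}

module Defs where

open import Data.Nat using (ℕ; zero; suc; _*_; _≤_)
open import Data.Bool using (Bool; true; false; T)
open import Data.Fin using (Fin; toℕ)
open import Data.Vec using (Vec; lookup)
open import Data.Product using (Σ; _×_)
open import Relation.Binary.PropositionalEquality using (_≡_)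
open import Relation.Nullary using (¬_)

record Digraph (n : ℕ) : Set where
  field
    arc : Fin n → Fin n → Bool
open Digraph public

data Reach⁺ {n : ℕ} (D : Digraph n) : Fin n → Fin n → Set where
  one  : ∀ {u v} → T (arc D u v) → Reach⁺ D u v
  more : ∀ {u v w} → T (arc D u v) → Reach⁺ D v w → Reach⁺ D u w

Acyclic : ∀ {n} → Digraph n → Set
Acyclic {n} D = (v : Fin n) → ¬ Reach⁺ D v v

IsSource : ∀ {n} → Digraph n → Fin n → Set
IsSource {n} D v = (u : Fin n) → arc D u v ≡ false

SingleSource : ∀ {n} → Digraph n → Set
SingleSource {n} D = Σ (Fin n) λ s → IsSource D s × ((v : Fin n) → IsSource D v → v ≡ s)

SingleSourceDAG : ∀ {n} → Digraph n → Set
SingleSourceDAG D = Acyclic D × SingleSource D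

-- Burned D xs t v : node v is burned after step t (t = 0: nothing burned).
-- Step t: all out-neighbours of burned nodes become burned (burned nodes stay
-- burned), then x_t = lookup xs (t-1) is burned.
data Burned {n b : ℕ} (D : Digraph n) (xs : Vec (Fin n) b) : ℕ → Fin n → Set where
  stay   : ∀ {t v} → Burned D xs t v → Burned D xs (suc t) v
  spread : ∀ {t u v} → Burned D xs t u → T (arc D u v) → Burned D xs (suc t) v
  ignite : (i : Fin b) → Burned D xs (suc (toℕ i)) (lookup xs i)

IsBurningSequence : ∀ {n b} → Digraph n → Vec (Fin n) b → Set
IsBurningSequence {n} {b} D xs = (v : Fin n) → Burned D xs b v

IsBurningNumber : ∀ {n} → Digraph n → ℕ → Set
IsBurningNumber {n} D b =
  Σ (Vec (Fin n) b) (IsBurningSequence D) ×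
  ((c : ℕ) (ys : Vec (Fin n) c) → IsBurningSequence D ys → b ≤ c)

-- ⌈√(2n+1/4) − 1/2⌉ characterised: for k ∈ ℕ,
-- √(2n+1/4) − 1/2 ≤ k  ⟺  2n ≤ k(k+1).  So the bound is the least such k.
IsCeilBound : ℕ → ℕ → Set
IsCeilBound n k = (2 * n ≤ k * suc k) × ((j : ℕ) → 2 * n ≤ j * suc j → k ≤ j)

-- Burn greedily, keeping the unburned nodes a set A closed under in-neighbours.
-- If 2|A| ≤ (k+1)(k+2), look for a centre w such that no node of A lies at distance
-- exactly k+1 from w, and either A lies within distance k of w or at least k+1 nodes
-- of A do.  Igniting w first burns that ball by the end of step k+1; the remaining
-- nodes of A are again closed under in-neighbours (nothing of A sits just outside
-- the ball) and satisfy 2|A'| ≤ k(k+1), so k further fires suffice by induction.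
-- The centre is found by starting at the source and, while some node v of A is at
-- distance exactly k+1, stepping to the second node of a shortest walk to v; by
-- acyclicity the remaining k+1 nodes of that walk are distinct, and the descent ends.
module Submission where

open import Defs
open import Data.Bool using (T)
open import Data.Empty using (⊥-elim)
open import Data.Fin using (Fin; toℕ; zero; suc)
open import Data.Fin.Properties using (any?; all?) renaming (_≟_ to _≟ᶠ_)
open import Data.Fin.Subset using (Subset; inside; outside; _∈_; _∉_; _⊆_; _∩_; ∁; ∣_∣; ⊤; Empty)
open import Data.Fin.Subset.Properties
  using (_∈?_; ∈⊤; ∣p∣≤n; ∣⊤∣≡n; ∣⊥∣≡0; Empty-unique; x∈p∩q⁺; x∈p∩q⁻; x∈∁p⇒x∉p; x∉p⇒x∈∁p;
         p⊂q⇒∣p∣<∣q∣; x∈p⇒∣p-x∣<∣p∣)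
open import Data.Nat using (ℕ; zero; suc; _+_; _*_; _≤_; _<_; z≤n; s≤s)
open import Data.Nat.Properties
open import Data.Nat.Tactic.RingSolver using (solve-∀)
open import Data.Product using (Σ; ∃; _×_; _,_; proj₂)
open import Data.Sum using (_⊎_; inj₁; inj₂; [_,_]′)
open import Data.Vec using (Vec; []; _∷_; lookup; tabulate)
open import Data.Vec.Properties using (lookup∘tabulate; []=⇒lookup; lookup⇒[]=)
open import Function using (_∘_)
open import Relation.Binary.PropositionalEquality
open import Relation.Nullary using (¬_; Dec; yes; no; does)
open import Relation.Nullary.Decidable using (map′; _⊎-dec_; _×-dec_; ¬?; T?; dec-true; dec-false; decidable-stable)
open import Relation.Unary using (Pred; Decidable)

module _ {n ℓ} {P : Pred (Fin n) ℓ} (P? : Decidable P) where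

  subset : Subset n
  subset = tabulate (does ∘ P?)

  ∈-subset⁺ : ∀ {x} → P x → x ∈ subset
  ∈-subset⁺ {x} Px = lookup⇒[]= x subset (trans (lookup∘tabulate (does ∘ P?) x) (dec-true (P? x) Px))

  ∈-subset⁻ : ∀ {x} → x ∈ subset → P x
  ∈-subset⁻ {x} x∈ with P? x | trans (sym (lookup∘tabulate (does ∘ P?) x)) ([]=⇒lookup x∈)
  ... | yes Px | _ = Px
  ... | no _   | ()

x∈p⇒0<∣p∣ : ∀ {n} {x : Fin n} {p} → x ∈ p → 0 < ∣ p ∣
x∈p⇒0<∣p∣ x∈p = ≤-trans (s≤s z≤n) (x∈p⇒∣p-x∣<∣p∣ x∈p)

∣p∣≡∣p∩q∣+∣p∩∁q∣ : ∀ {n} (p q : Subset n) → ∣ p ∣ ≡ ∣ p ∩ q ∣ + ∣ p ∩ ∁ q ∣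
∣p∣≡∣p∩q∣+∣p∩∁q∣ []            []            = refl
∣p∣≡∣p∩q∣+∣p∩∁q∣ (inside ∷ p)  (inside ∷ q)  = cong suc (∣p∣≡∣p∩q∣+∣p∩∁q∣ p q)
∣p∣≡∣p∩q∣+∣p∩∁q∣ (inside ∷ p)  (outside ∷ q) = trans (cong suc (∣p∣≡∣p∩q∣+∣p∩∁q∣ p q)) (sym (+-suc _ _))
∣p∣≡∣p∩q∣+∣p∩∁q∣ (outside ∷ p) (_ ∷ q)       = ∣p∣≡∣p∩q∣+∣p∩∁q∣ p q

triangle-step : ∀ {c d} k → c + suc k ≤ d → 2 * d ≤ suc k * suc (suc k) → 2 * c ≤ k * suc k
triangle-step {c} {d} k c+k<d 2d≤ = +-cancelʳ-≤ (2 * suc k) (2 * c) (k * suc k) (begin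
  2 * c + 2 * suc k       ≡⟨ *-distribˡ-+ 2 c (suc k) ⟨
  2 * (c + suc k)         ≤⟨ *-monoʳ-≤ 2 c+k<d ⟩
  2 * d                   ≤⟨ 2d≤ ⟩
  suc k * suc (suc k)     ≡⟨ expand k ⟩
  k * suc k + 2 * suc k   ∎)
  where
  open ≤-Reasoning
  expand : ∀ k → suc k * suc (suc k) ≡ k * suc k + 2 * suc k
  expand = solve-∀

2∣p∩∁q∣≤k[k+1] : ∀ {n} k (p q : Subset n) → p ⊆ q ⊎ k < ∣ p ∩ q ∣ →
                 2 * ∣ p ∣ ≤ suc k * suc (suc k) → 2 * ∣ p ∩ ∁ q ∣ ≤ k * suc k
2∣p∩∁q∣≤k[k+1] {n} k p q (inj₁ p⊆q) _ = subst (λ c → 2 * c ≤ k * suc k) (sym ∣p∩∁q∣≡0) z≤n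
  where
  empty : Empty (p ∩ ∁ q)
  empty (x , x∈) with x∈p∩q⁻ p (∁ q) x∈
  ... | x∈p , x∈∁q = x∈∁p⇒x∉p x∈∁q (p⊆q x∈p)
  ∣p∩∁q∣≡0 : ∣ p ∩ ∁ q ∣ ≡ 0
  ∣p∩∁q∣≡0 = trans (cong ∣_∣ (Empty-unique empty)) (∣⊥∣≡0 n)
2∣p∩∁q∣≤k[k+1] k p q (inj₂ k<∣p∩q∣) = triangle-step k (begin
  ∣ p ∩ ∁ q ∣ + suc k         ≤⟨ +-monoʳ-≤ ∣ p ∩ ∁ q ∣ k<∣p∩q∣ ⟩
  ∣ p ∩ ∁ q ∣ + ∣ p ∩ q ∣     ≡⟨ +-comm ∣ p ∩ ∁ q ∣ _ ⟩
  ∣ p ∩ q ∣ + ∣ p ∩ ∁ q ∣     ≡⟨ ∣p∣≡∣p∩q∣+∣p∩∁q∣ p q ⟨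
  ∣ p ∣                       ∎)
  where open ≤-Reasoning

least : ∀ {ℓ} {P : Pred ℕ ℓ} → Decidable P → ∀ {k} → P k →
        Σ ℕ λ b → P b × b ≤ k × (∀ {c} → P c → b ≤ c)
least P? {zero} P0 = 0 , P0 , z≤n , λ _ → z≤n
least {P = P} P? {suc k} Pk with P? 0
... | yes P0 = 0 , P0 , z≤n , λ _ → z≤n
... | no ¬P0 with least (P? ∘ suc) Pk
...   | b , Pb , b≤k , minimal = suc b , Pb , s≤s b≤k , minimal′
  where
  minimal′ : ∀ {c} → P c → suc b ≤ c
  minimal′ {zero}  P0 = ⊥-elim (¬P0 P0)
  minimal′ {suc c} Pc = s≤s (minimal Pc)

anyVec? : ∀ {n ℓ} c {P : Pred (Vec (Fin n) c) ℓ} → Decidable P → Dec (∃ P)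
anyVec? zero    P? = map′ ([] ,_) (λ { ([] , p) → p }) (P? [])
anyVec? (suc c) P? = map′ (λ (x , xs , p) → x ∷ xs , p) (λ { (x ∷ xs , p) → x , xs , p })
                          (any? λ x → anyVec? c (P? ∘ (x ∷_)))

module _ {n : ℕ} (D : Digraph n) where

  Arc : Fin n → Fin n → Set
  Arc u v = T (arc D u v)

  infixr 5 _◅_
  data Walk : ℕ → Fin n → Fin n → Set where
    ε   : ∀ {u} → Walk 0 u u
    _◅_ : ∀ {m u v w} → Arc u v → Walk m v w → Walk (suc m) u w

  _▻_ : ∀ {m u v w} → Walk m u v → Arc v w → Walk (suc m) u w
  ε       ▻ a = a ◅ ε
  (b ◅ p) ▻ a = b ◅ (p ▻ a)

  -- Within r u v: a walk of length r from u to v that may pause, i.e. dist(u, v) ≤ r.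
  data Within : ℕ → Fin n → Fin n → Set where
    here : ∀ {u} → Within 0 u u
    wait : ∀ {r u v} → Within r u v → Within (suc r) u v
    step : ∀ {r u x v} → Arc u x → Within r x v → Within (suc r) u v

  within-refl : ∀ r {u} → Within r u u
  within-refl zero    = here
  within-refl (suc r) = wait (within-refl r)

  within-▻ : ∀ {r u x v} → Within r u x → Arc x v → Within (suc r) u v
  within-▻ here       a = step a here
  within-▻ (wait p)   a = wait (within-▻ p a)
  within-▻ (step b p) a = step b (within-▻ p a)

  arc-within⇒Reach⁺ : ∀ {r u x v} → Arc u x → Within r x v → Reach⁺ D u v
  arc-within⇒Reach⁺ a here       = one a
  arc-within⇒Reach⁺ a (wait p)   = arc-within⇒Reach⁺ a p
  arc-within⇒Reach⁺ a (step b p) = more a (arc-within⇒Reach⁺ b p)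

  within-tight : ∀ {r w v} → Within (suc r) w v → ¬ Within r w v → Walk (suc r) w v
  within-tight         (wait p)      ¬p = ⊥-elim (¬p p)
  within-tight {zero}  (step a here) _  = a ◅ ε
  within-tight {suc r} (step a p)    ¬p = a ◅ within-tight p (¬p ∘ step a)

  within? : ∀ r u v → Dec (Within r u v)
  within? zero    u v = map′ (λ { refl → here }) (λ { here → refl }) (u ≟ᶠ v)
  within? (suc r) u v = map′ [ wait , (λ (x , a , p) → step a p) ]′ unstep
    (within? r u v ⊎-dec any? (λ x → T? (arc D u x) ×-dec within? r x v))
    where
    unstep : Within (suc r) u v → Within r u v ⊎ ∃ λ x → Arc u x × Within r x v
    unstep (wait p)   = inj₁ p
    unstep (step a p) = inj₂ (_ , a , p)

  ball : Fin n → ℕ → Subset n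
  ball u r = subset (within? r u)

  ∈-ball⁺ : ∀ {r u v} → Within r u v → v ∈ ball u r
  ∈-ball⁺ {r} {u} = ∈-subset⁺ (within? r u)

  ∈-ball⁻ : ∀ {r u v} → v ∈ ball u r → Within r u v
  ∈-ball⁻ {r} {u} = ∈-subset⁻ (within? r u)

  PredClosed : Subset n → Set
  PredClosed A = ∀ {u v} → Arc u v → v ∈ A → u ∈ A

  walk-closed : ∀ {A m u v} → PredClosed A → Walk m u v → v ∈ A → u ∈ A
  walk-closed closed ε       v∈A = v∈A
  walk-closed closed (a ◅ p) v∈A = closed a (walk-closed closed p v∈A)

  PredClosed-∩∁ball : ∀ {A w k} → PredClosed A → A ∩ ball w (suc k) ⊆ ball w k →
                      PredClosed (A ∩ ∁ (ball w k))
  PredClosed-∩∁ball {A} closed settled a v∈ with x∈p∩q⁻ A _ v∈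
  ... | v∈A , v∉ball = x∈p∩q⁺ (closed a v∈A , x∉p⇒x∈∁p λ u∈ball →
          x∈∁p⇒x∉p v∉ball (settled (x∈p∩q⁺ (v∈A , ∈-ball⁺ (within-▻ (∈-ball⁻ u∈ball) a)))))

  burned-within : ∀ {b} {xs : Vec (Fin n) b} {t m u v} →
                  Burned D xs t u → Within m u v → Burned D xs (m + t) v
  burned-within bu here       = bu
  burned-within bu (wait p)   = stay (burned-within bu p)
  burned-within {xs = xs} {t} {suc m} {v = v} bu (step a p) =
    subst (λ t′ → Burned D xs t′ v) (+-suc m t) (burned-within (spread bu a) p)

  burned-ball : ∀ {b} {xs : Vec (Fin n) b} {k w v} → Within k w v → Burned D (w ∷ xs) (suc k) v
  burned-ball {xs = xs} {k} {w} {v} p =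
    subst (λ t → Burned D (w ∷ xs) t v) (+-comm k 1) (burned-within (ignite zero) p)

  burned-∷ : ∀ {b} {xs : Vec (Fin n) b} {x t v} → Burned D xs t v → Burned D (x ∷ xs) (suc t) v
  burned-∷ (stay p)     = stay (burned-∷ p)
  burned-∷ (spread p a) = spread (burned-∷ p) a
  burned-∷ (ignite i)   = ignite (suc i)

  Burned-suc⁻ : ∀ {b} {xs : Vec (Fin n) b} {t v} → Burned D xs (suc t) v →
                Burned D xs t v ⊎ (∃ λ u → Burned D xs t u × Arc u v) ⊎
                (∃ λ i → toℕ i ≡ t × lookup xs i ≡ v)
  Burned-suc⁻ (stay p)     = inj₁ p
  Burned-suc⁻ (spread p a) = inj₂ (inj₁ (_ , p , a))
  Burned-suc⁻ (ignite i)   = inj₂ (inj₂ (i , refl , refl))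

  burned? : ∀ {b} (xs : Vec (Fin n) b) t v → Dec (Burned D xs t v)
  burned? xs zero    v = no λ ()
  burned? xs (suc t) v =
    map′ [ stay , [ (λ (u , p , a) → spread p a) , (λ { (i , refl , refl) → ignite i }) ]′ ]′ Burned-suc⁻
      (burned? xs t v ⊎-dec
        (any? (λ u → burned? xs t u ×-dec T? (arc D u v)) ⊎-dec
         any? (λ i → toℕ i ≟ t ×-dec lookup xs i ≟ᶠ v)))

  burning? : ∀ c → Dec (∃ λ (ys : Vec (Fin n) c) → IsBurningSequence D ys)
  burning? c = anyVec? c λ ys → all? (burned? ys c)

  burningNumber-≤ : ∀ {k} (xs : Vec (Fin n) k) → IsBurningSequence D xs →
                    Σ ℕ λ b → IsBurningNumber D b × b ≤ k
  burningNumber-≤ xs burns with least burning? (xs , burns)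
  ... | b , sequence , b≤k , minimal = b , (sequence , λ _ ys burnsʸ → minimal (ys , burnsʸ)) , b≤k

  module _ (acyclic : Acyclic D) where

    walk⇒r<∣A∩ball∣ : ∀ {A r u v} → PredClosed A → Walk r u v → v ∈ A → r < ∣ A ∩ ball u r ∣
    walk⇒r<∣A∩ball∣ closed ε v∈A = x∈p⇒0<∣p∣ (x∈p∩q⁺ (v∈A , ∈-ball⁺ here))
    walk⇒r<∣A∩ball∣ {A} {suc r} {u} closed (_◅_ {v = x} a p) v∈A =
      ≤-trans (s≤s (walk⇒r<∣A∩ball∣ closed p v∈A)) (p⊂q⇒∣p∣<∣q∣ (grows , u , u∈new , u∉old))
      where
      grows : A ∩ ball x r ⊆ A ∩ ball u (suc r)
      grows y∈ with x∈p∩q⁻ A _ y∈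
      ... | y∈A , y∈ball = x∈p∩q⁺ (y∈A , ∈-ball⁺ (step a (∈-ball⁻ y∈ball)))
      u∈new : u ∈ A ∩ ball u (suc r)
      u∈new = x∈p∩q⁺ (walk-closed closed (a ◅ p) v∈A , ∈-ball⁺ (within-refl (suc r)))
      u∉old : u ∉ A ∩ ball x r
      u∉old u∈ = acyclic u (arc-within⇒Reach⁺ a (∈-ball⁻ {r} {x} (proj₂ (x∈p∩q⁻ A _ u∈))))

    walk-length<n : ∀ {m u v} → Walk m u v → m < n
    walk-length<n {m} {u} p = <-≤-trans (walk⇒r<∣A∩ball∣ {⊤} (λ _ _ → ∈⊤) p ∈⊤) (∣p∣≤n (⊤ ∩ ball u m))

    module _ {s : Fin n} (sole : ∀ v → IsSource D v → v ≡ s) where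

      reachable : ∀ v → ∃ λ m → Walk m s v
      reachable v = go n ε (m≤m+n n 0)
        where
        go : ∀ fuel {m u} → Walk m u v → n ≤ fuel + m → ∃ λ m → Walk m s v
        go zero p n≤m = ⊥-elim (<⇒≱ (walk-length<n p) n≤m)
        go (suc fuel) {m} {u} p n≤fuel+m with u ≟ᶠ s | any? (λ x → T? (arc D x u))
        ... | yes refl | _           = m , p
        -- does (T? b) reduces to b, so dec-false yields arc D x u ≡ false.
        ... | no u≢s   | no noArc    = ⊥-elim (u≢s (sole u λ x → dec-false (T? (arc D x u)) (noArc ∘ (x ,_))))
        ... | no _     | yes (x , a) = go fuel (a ◅ p) (≤-trans n≤fuel+m (≤-reflexive (sym (+-suc fuel m))))

      ⊆ball-source : ∀ {k A} → PredClosed A → A ∩ ball s (suc k) ⊆ ball s k → A ⊆ ball s k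
      ⊆ball-source {k} {A} closed settled {v} v∈A = along (proj₂ (reachable v)) (∈-ball⁺ (within-refl k))
        where
        along : ∀ {m u} → Walk m u v → u ∈ ball s k → v ∈ ball s k
        along ε       u∈ = u∈
        along (a ◅ p) u∈ = along p (settled (x∈p∩q⁺ (walk-closed closed p v∈A , ∈-ball⁺ (within-▻ (∈-ball⁻ u∈) a))))

      descend : ∀ k {A} → PredClosed A → ∀ fuel {m w} → Walk m s w → n ≤ fuel + m →
                w ≡ s ⊎ k < ∣ A ∩ ball w k ∣ →
                ∃ λ w → A ∩ ball w (suc k) ⊆ ball w k × (w ≡ s ⊎ k < ∣ A ∩ ball w k ∣)
      descend k closed zero p n≤m _ = ⊥-elim (<⇒≱ (walk-length<n p) n≤m)
      descend k {A} closed (suc fuel) {m} {w} p n≤fuel+m large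
        with any? (λ v → (v ∈? A) ×-dec within? (suc k) w v ×-dec ¬? (within? k w v))
      ... | no noBoundary = w , settled , large
        where
        settled : A ∩ ball w (suc k) ⊆ ball w k
        settled {v} v∈ with x∈p∩q⁻ A _ v∈
        ... | v∈A , v∈ball = ∈-ball⁺ (decidable-stable (within? k w v)
                                λ far → noBoundary (v , v∈A , ∈-ball⁻ v∈ball , far))
      ... | yes (v , v∈A , near , far) with within-tight near far
      ...   | a ◅ q = descend k closed fuel (p ▻ a) (≤-trans n≤fuel+m (≤-reflexive (sym (+-suc fuel m))))
                        (inj₂ (walk⇒r<∣A∩ball∣ closed q v∈A))

      centre : ∀ k A → PredClosed A →
               ∃ λ w → A ∩ ball w (suc k) ⊆ ball w k × (A ⊆ ball w k ⊎ k < ∣ A ∩ ball w k ∣)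
      centre k A closed with descend k closed n ε (m≤m+n n 0) (inj₁ refl)
      ... | w , settled , inj₁ refl  = w , settled , inj₁ (⊆ball-source closed settled)
      ... | w , settled , inj₂ large = w , settled , inj₂ large

      burnable : ∀ k A → PredClosed A → 2 * ∣ A ∣ ≤ k * suc k →
                 ∃ λ (xs : Vec (Fin n) k) → ∀ {v} → v ∈ A → Burned D xs k v
      burnable zero A _ 2∣A∣≤0 =
        [] , λ v∈A → ⊥-elim (<⇒≱ (x∈p⇒0<∣p∣ v∈A) (≤-trans (m≤m+n ∣ A ∣ _) 2∣A∣≤0))
      burnable (suc k) A closed bound with centre k A closed
      ... | w , settled , small
        with burnable k (A ∩ ∁ (ball w k)) (PredClosed-∩∁ball closed settled)
                        (2∣p∩∁q∣≤k[k+1] k A (ball w k) small bound)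
      ... | xs , burnsRest = w ∷ xs , burns
        where
        burns : ∀ {v} → v ∈ A → Burned D (w ∷ xs) (suc k) v
        burns {v} v∈A with within? k w v
        ... | yes near = burned-ball near
        ... | no far   = burned-∷ (burnsRest (x∈p∩q⁺ (v∈A , x∉p⇒x∈∁p (far ∘ ∈-ball⁻))))

mainTheorem5 : (n : ℕ) (D : Digraph n) → SingleSourceDAG D →
    (k : ℕ) → IsCeilBound n k →
    Σ ℕ λ b → IsBurningNumber D b × b ≤ k
mainTheorem5 n D (acyclic , _ , _ , sole) k (2n≤k[k+1] , _)
  with burnable D acyclic sole k ⊤ (λ _ _ → ∈⊤) (subst (λ m → 2 * m ≤ k * suc k) (sym (∣⊤∣≡n n)) 2n≤k[k+1])
... | xs , burns = burningNumber-≤ D xs (λ _ → burns ∈⊤)
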